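{- Let $n$ be a positive integer and, for $\mathbf{x}\in\mathbb{R}^n$, define $$f_n(\mathbf{x})=\prod_{j=1}^{n}(1-x_j)+\sum_{j=1}^{n}x_j\prod_{k\in[n],\,k\neq j}(1-x_k).$$ Then for every $\mathbf{x}$ with $x_i\ge 0$ for all $i$ and $\sum_{i=1}^n x_i\le 1$, $$f_n(\mathbf{x})\ge\Bigl(1-\tfrac1n\Bigr)^n+\Bigl(1-\tfrac1n\Bigr)^{n-1},$$ and equality is attained at $\mathbf{x}=(\tfrac1n,\dots,\tfrac1n)$. -}

module Defs where

open import Level using (Level; _⊔_) renaming (suc to lsuc)
open import Data.Nat using (ℕ; zero; suc)
open import Data.Fin using (Fin; zero; suc; _≟_)
open import Data.Product using (Σ; ∃; _×_; _,_)
open import Relation.Nullary using (¬_; yes; no)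
open import Algebra.Bundles using (CommutativeRing)
open import Relation.Binary.Structures using (IsTotalOrder)

-- A model of the real numbers: a Dedekind-complete ordered field.
-- (Any two such structures are isomorphic to ℝ.)
record RealField (c ℓ : Level) : Set (lsuc (c ⊔ ℓ)) where
  field
    commRing : CommutativeRing c ℓ
  open CommutativeRing commRing public
  field
    _≤_          : Carrier → Carrier → Set ℓ
    isTotalOrder : IsTotalOrder _≈_ _≤_
    0≉1          : ¬ (0# ≈ 1#)
    inverse      : ∀ x → ¬ (x ≈ 0#) → ∃ λ y → x * y ≈ 1#
    +-monoʳ-≤    : ∀ {x y} z → x ≤ y → (x + z) ≤ (y + z)
    *-nonneg     : ∀ {x y} → 0# ≤ x → 0# ≤ y → 0# ≤ (x * y)
    complete     : (P : Carrier → Set ℓ) → (∃ λ x → P x) →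
                   (∃ λ b → ∀ x → P x → x ≤ b) →
                   ∃ λ s → (∀ x → P x → x ≤ s) ×
                           (∀ b → (∀ x → P x → x ≤ b) → s ≤ b)

module _ {c ℓ} (R : RealField c ℓ) where
  open RealField R using (Carrier; _≈_; 0#; 1#; _+_; _*_; _-_)

  fromℕ : ℕ → Carrier
  fromℕ zero    = 0#
  fromℕ (suc n) = 1# + fromℕ n

  pow : Carrier → ℕ → Carrier
  pow x zero    = 1#
  pow x (suc n) = x * pow x n

  ∑ : ∀ n → (Fin n → Carrier) → Carrier
  ∑ zero    f = 0#
  ∑ (suc n) f = f zero + ∑ n (λ i → f (suc i))

  ∏ : ∀ n → (Fin n → Carrier) → Carrier
  ∏ zero    f = 1#
  ∏ (suc n) f = f zero * ∏ n (λ i → f (suc i))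

  ∏-except : ∀ n → Fin n → (Fin n → Carrier) → Carrier
  except : ∀ {n} → Fin n → (Fin n → Carrier) → Fin n → Carrier
  except j g k with k ≟ j
  ... | yes _ = 1#
  ... | no  _ = g k

  ∏-except n j g = ∏ n (except j g)

  f : ∀ n → (Fin n → Carrier) → Carrier
  f n x = ∏ n (λ j → 1# - x j)
        + ∑ n (λ j → x j * ∏-except n j (λ k → 1# - x k))

-- Write f = P₀ + P₁, where P₀ and P₁ are the probabilities that none, resp. exactly
-- one, of independent events with probabilities xⱼ occurs.  Raising a coordinate lowers
-- f, so we may assume ∑ xⱼ = 1 = nq.  By induction on the dimension, the weighted
-- function Φ = α P₀ + β P₁ is minimised at the constant vector among nonnegative
-- vectors of mean q, provided (α , β) satisfies an invariant.  In the inductive step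
-- the smallest coordinate u is raised to q and the largest remaining one v lowered to
-- u + v - q.  This keeps their sum and raises their product by (q - u)(v - q), which
-- changes Φ by that amount times -((2β - α) P₀ - β P₁) of the other coordinates, and
-- an auxiliary induction (P₁-bound) shows this factor is ≤ 0.  Peeling off the
-- coordinate now equal to q turns (α , β) into (α(1 - q) + βq , β(1 - q)), and the
-- invariant is preserved.
module Submission where

open import Defs
open import Data.Nat as ℕ using (ℕ; zero; suc; _∸_) renaming (_≤_ to _≤ℕ_)
open import Data.Fin using (Fin; zero; suc; punchIn; _≟_)
open import Data.Vec.Functional using (_∷_; tail; insertAt; removeAt)
open import Data.Vec.Functional.Properties using (insertAt-lookup; insertAt-punchIn)
open import Data.Product using (Σ; _×_; _,_; proj₁; proj₂)
open import Data.Product.Properties using (≡-dec)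
open import Data.Sum using (inj₁; inj₂)
open import Data.Maybe using (Maybe; just; nothing)
open import Data.Empty using (⊥-elim)
open import Function using (_∘_)
open import Relation.Nullary using (yes; no)
import Relation.Binary.PropositionalEquality as ≡
open import Relation.Binary.Bundles using (Poset)
open import Relation.Binary.Structures using (IsTotalOrder)
import Relation.Binary.Reasoning.Setoid
import Relation.Binary.Reasoning.PartialOrder
open import Algebra.Bundles using (RawRing)
import Algebra.Solver.Ring.AlmostCommutativeRing as ACR
import Algebra.Solver.Ring as RingSolver

-- The standard ring solver needs coefficients with a (weakly) decidable equality, which
-- the field does not have, so we supply the integers: a pair (a , b) stands for a - b.
-- Pairs are kept normalised (one component zero), so that syntactic equality of
-- coefficients decides equality, and ⟦_⟧ sends 0 and 1 to 0# and 1# on the nose.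
module IntegerCoefficientSolver {c ℓ} (R : RealField c ℓ) where
  open RealField R
  open import Algebra.Properties.Semiring.Mult.TCOptimised semiring
    using (1+×; ×-homo-+; ×1-homo-*) renaming (_×_ to _·_)
  open import Algebra.Properties.Ring ring
    using (-‿distribˡ-*; -‿distribʳ-*; -‿involutive; -0#≈0#)
  open import Algebra.Properties.AbelianGroup +-abelianGroup using (⁻¹-∙-comm)
  open import Relation.Binary.Reasoning.Setoid setoid

  private
    normalise : ℕ × ℕ → ℕ × ℕ
    normalise (a , b) = (a ∸ b , b ∸ a)

    ℤ-rawRing : RawRing _ _
    ℤ-rawRing = record
      { Carrier = ℕ × ℕ
      ; _≈_ = ≡._≡_
      ; _+_ = λ { (a , b) (c , d) → normalise (a ℕ.+ c , b ℕ.+ d) }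
      ; _*_ = λ { (a , b) (c , d) → normalise (a ℕ.* c ℕ.+ b ℕ.* d , a ℕ.* d ℕ.+ b ℕ.* c) }
      ; -_  = λ { (a , b) → (b , a) }
      ; 0#  = (0 , 0)
      ; 1#  = (1 , 0)
      }

    ⟦_⟧ : ℕ × ℕ → Carrier
    ⟦ a , zero ⟧      = a · 1#
    ⟦ zero , suc b ⟧  = - (suc b · 1#)
    ⟦ suc a , suc b ⟧ = ⟦ a , b ⟧

    ⟦normalise⟧ : ∀ p → ⟦ normalise p ⟧ ≈ ⟦ p ⟧
    ⟦normalise⟧ (zero , zero)   = refl
    ⟦normalise⟧ (zero , suc b)  = refl
    ⟦normalise⟧ (suc a , zero)  = refl
    ⟦normalise⟧ (suc a , suc b) = ⟦normalise⟧ (a , b)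

    -‿+-distrib : ∀ x y → - (x + y) ≈ - x + - y
    -‿+-distrib x y = sym (⁻¹-∙-comm x y)

    +-sub-+ : ∀ a b c d → (a + c) - (b + d) ≈ (a - b) + (c - d)
    +-sub-+ a b c d = begin
      (a + c) + - (b + d)   ≈⟨ +-cong refl (-‿+-distrib b d) ⟩
      (a + c) + (- b + - d) ≈⟨ +-assoc a c _ ⟩
      a + (c + (- b + - d)) ≈⟨ +-cong refl (trans (sym (+-assoc c _ _))
                                        (trans (+-cong (+-comm c _) refl) (+-assoc _ c _))) ⟩
      a + (- b + (c - d))   ≈⟨ sym (+-assoc a _ _) ⟩
      (a - b) + (c - d)     ∎

    -‿sub : ∀ x y → - (x - y) ≈ y - x
    -‿sub x y = trans (-‿+-distrib x (- y)) (trans (+-cong refl (-‿involutive y)) (+-comm _ _))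

    sub-*-sub : ∀ a b c d → (a - b) * (c - d) ≈ (a * c + b * d) - (a * d + b * c)
    sub-*-sub a b c d = begin
      (a - b) * (c - d)                         ≈⟨ distribʳ _ _ _ ⟩
      a * (c - d) + - b * (c - d)               ≈⟨ +-cong (distribˡ _ _ _) (distribˡ _ _ _) ⟩
      (a * c + a * - d) + (- b * c + - b * - d)
        ≈⟨ +-cong (+-cong refl (sym (-‿distribʳ-* a d)))
                  (+-cong (sym (-‿distribˡ-* b c))
                          (trans (sym (-‿distribˡ-* b (- d)))
                                 (trans (-‿cong (sym (-‿distribʳ-* b d))) (-‿involutive _)))) ⟩
      (a * c - a * d) + (- (b * c) + b * d)     ≈⟨ +-cong refl (+-comm _ _) ⟩
      (a * c - a * d) + (b * d - b * c)         ≈⟨ sym (+-sub-+ _ _ _ _) ⟩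
      (a * c + b * d) - (a * d + b * c)         ∎

    ⟦⟧≈difference : ∀ a b → ⟦ a , b ⟧ ≈ a · 1# - b · 1#
    ⟦⟧≈difference a       zero    = sym (trans (+-cong refl -0#≈0#) (+-identityʳ _))
    ⟦⟧≈difference zero    (suc b) = sym (+-identityˡ _)
    ⟦⟧≈difference (suc a) (suc b) = begin
      ⟦ a , b ⟧                         ≈⟨ ⟦⟧≈difference a b ⟩
      a · 1# - b · 1#                   ≈⟨ sym (+-identityˡ _) ⟩
      0# + (a · 1# - b · 1#)            ≈⟨ +-cong (sym (-‿inverseʳ 1#)) refl ⟩
      (1# - 1#) + (a · 1# - b · 1#)     ≈⟨ sym (+-sub-+ 1# 1# _ _) ⟩
      (1# + a · 1#) - (1# + b · 1#)     ≈⟨ sym (+-cong (1+× a 1#) (-‿cong (1+× b 1#))) ⟩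
      suc a · 1# - suc b · 1#           ∎

    ⟦⟧-+-homo : ∀ a b c d → ⟦ a ℕ.+ c , b ℕ.+ d ⟧ ≈ ⟦ a , b ⟧ + ⟦ c , d ⟧
    ⟦⟧-+-homo a b c d = begin
      ⟦ a ℕ.+ c , b ℕ.+ d ⟧                 ≈⟨ ⟦⟧≈difference (a ℕ.+ c) (b ℕ.+ d) ⟩
      (a ℕ.+ c) · 1# - (b ℕ.+ d) · 1#       ≈⟨ +-cong (×-homo-+ 1# a c) (-‿cong (×-homo-+ 1# b d)) ⟩
      (a · 1# + c · 1#) - (b · 1# + d · 1#) ≈⟨ +-sub-+ _ _ _ _ ⟩
      (a · 1# - b · 1#) + (c · 1# - d · 1#) ≈⟨ sym (+-cong (⟦⟧≈difference a b) (⟦⟧≈difference c d)) ⟩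
      ⟦ a , b ⟧ + ⟦ c , d ⟧                 ∎

    ⟦⟧-*-homo : ∀ a b c d →
      ⟦ a ℕ.* c ℕ.+ b ℕ.* d , a ℕ.* d ℕ.+ b ℕ.* c ⟧ ≈ ⟦ a , b ⟧ * ⟦ c , d ⟧
    ⟦⟧-*-homo a b c d = begin
      ⟦ a ℕ.* c ℕ.+ b ℕ.* d , a ℕ.* d ℕ.+ b ℕ.* c ⟧
        ≈⟨ ⟦⟧-+-homo (a ℕ.* c) (a ℕ.* d) (b ℕ.* d) (b ℕ.* c) ⟩
      ⟦ a ℕ.* c , a ℕ.* d ⟧ + ⟦ b ℕ.* d , b ℕ.* c ⟧
        ≈⟨ +-cong (⟦⟧≈difference (a ℕ.* c) (a ℕ.* d)) (⟦⟧≈difference (b ℕ.* d) (b ℕ.* c)) ⟩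
      ((a ℕ.* c) · 1# - (a ℕ.* d) · 1#) + ((b ℕ.* d) · 1# - (b ℕ.* c) · 1#)
        ≈⟨ +-cong (+-cong (×1-homo-* a c) (-‿cong (×1-homo-* a d)))
                  (+-cong (×1-homo-* b d) (-‿cong (×1-homo-* b c))) ⟩
      (A * C - A * D) + (B * D - B * C)  ≈⟨ sym (+-sub-+ _ _ _ _) ⟩
      (A * C + B * D) - (A * D + B * C)  ≈⟨ sym (sub-*-sub A B C D) ⟩
      (A - B) * (C - D)                  ≈⟨ sym (*-cong (⟦⟧≈difference a b) (⟦⟧≈difference c d)) ⟩
      ⟦ a , b ⟧ * ⟦ c , d ⟧              ∎
      where A = a · 1#; B = b · 1#; C = c · 1#; D = d · 1#

    homomorphism : ℤ-rawRing ACR.-Raw-AlmostCommutative⟶ ACR.fromCommutativeRing commRing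
    homomorphism = record
      { ⟦_⟧    = ⟦_⟧
      ; +-homo = λ { (a , b) (c , d) →
          trans (⟦normalise⟧ (a ℕ.+ c , b ℕ.+ d)) (⟦⟧-+-homo a b c d) }
      ; *-homo = λ { (a , b) (c , d) →
          trans (⟦normalise⟧ (a ℕ.* c ℕ.+ b ℕ.* d , a ℕ.* d ℕ.+ b ℕ.* c)) (⟦⟧-*-homo a b c d) }
      ; -‿homo = λ { (a , b) → begin
          ⟦ b , a ⟧           ≈⟨ ⟦⟧≈difference b a ⟩
          b · 1# - a · 1#     ≈⟨ sym (-‿sub (a · 1#) (b · 1#)) ⟩
          - (a · 1# - b · 1#) ≈⟨ -‿cong (sym (⟦⟧≈difference a b)) ⟩
          - ⟦ a , b ⟧         ∎ }
      ; 0-homo = refl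
      ; 1-homo = refl
      }

    ≟-coefficient : ∀ p q → Maybe (⟦ p ⟧ ≈ ⟦ q ⟧)
    ≟-coefficient p q with ≡-dec ℕ._≟_ ℕ._≟_ p q
    ... | yes ≡.refl = just refl
    ... | no _       = nothing

  open RingSolver ℤ-rawRing (ACR.fromCommutativeRing commRing) homomorphism ≟-coefficient public
    using (solve; _:=_; _:+_; _:*_; _:-_; con; Polynomial)

  𝟎 𝟏 : ∀ {n} → Polynomial n
  𝟎 = con (0 , 0)
  𝟏 = con (1 , 0)

module Proof {c ℓ} (R : RealField c ℓ) where
  open RealField R hiding (zero) renaming (_≤_ to infix 4 _≤_)
  open IntegerCoefficientSolver R
  open IsTotalOrder isTotalOrder using (total; antisym)
    renaming (refl to ≤-refl; reflexive to ≤-reflexive; trans to ≤-trans;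
              ≲-respˡ-≈ to ≤-respˡ-≈; ≲-respʳ-≈ to ≤-respʳ-≈)

  poset : Poset c ℓ ℓ
  poset = record { isPartialOrder = IsTotalOrder.isPartialOrder isTotalOrder }

  module ≈-Reasoning = Relation.Binary.Reasoning.Setoid setoid
  module ≤-Reasoning = Relation.Binary.Reasoning.PartialOrder poset

  x≤y⇒0≤y-x : ∀ {x y} → x ≤ y → 0# ≤ y - x
  x≤y⇒0≤y-x {x} x≤y = ≤-respˡ-≈ (-‿inverseʳ x) (+-monoʳ-≤ (- x) x≤y)

  0≤y-x⇒x≤y : ∀ {x y} → 0# ≤ y - x → x ≤ y
  0≤y-x⇒x≤y {x} {y} 0≤y-x = ≤-respˡ-≈ (+-identityˡ x)
    (≤-respʳ-≈ (solve 2 (λ x y → (y :- x) :+ x := y) refl x y) (+-monoʳ-≤ x 0≤y-x))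

  ≤-by-diff : ∀ {x y d} → y - x ≈ d → 0# ≤ d → x ≤ y
  ≤-by-diff y-x≈d 0≤d = 0≤y-x⇒x≤y (≤-respʳ-≈ (sym y-x≈d) 0≤d)

  x≤x+y : ∀ {x y} → 0# ≤ y → x ≤ x + y
  x≤x+y {x} {y} = ≤-by-diff (solve 2 (λ x y → (x :+ y) :- x := y) refl x y)

  +-nonneg : ∀ {x y} → 0# ≤ x → 0# ≤ y → 0# ≤ x + y
  +-nonneg 0≤x 0≤y = ≤-trans 0≤x (x≤x+y 0≤y)

  +-mono-≤ : ∀ {a b x y} → a ≤ b → x ≤ y → a + x ≤ b + y
  +-mono-≤ {a} {b} {x} {y} a≤b x≤y = ≤-by-diff
    (solve 4 (λ a b x y → (b :+ y) :- (a :+ x) := (b :- a) :+ (y :- x)) refl a b x y)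
    (+-nonneg (x≤y⇒0≤y-x a≤b) (x≤y⇒0≤y-x x≤y))

  +-cancel-≤ : ∀ {a b x y} → a + x ≈ b + y → a ≤ b → y ≤ x
  +-cancel-≤ {a} {b} {x} {y} a+x≈b+y a≤b = ≤-by-diff x-y≈b-a (x≤y⇒0≤y-x a≤b)
    where
    open ≈-Reasoning
    x-y≈b-a : x - y ≈ b - a
    x-y≈b-a = begin
      x - y             ≈⟨ solve 3 (λ a x y → x :- y := (a :+ x) :- (a :+ y)) refl a x y ⟩
      (a + x) - (a + y) ≈⟨ +-cong a+x≈b+y refl ⟩
      (b + y) - (a + y) ≈⟨ solve 3 (λ a b y → (b :+ y) :- (a :+ y) := b :- a) refl a b y ⟩
      b - a             ∎

  0≤1 : 0# ≤ 1#
  0≤1 with total 0# 1#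
  ... | inj₁ 0≤1 = 0≤1
  ... | inj₂ 1≤0 = ≤-respʳ-≈ (solve 0 ((𝟎 :- 𝟏) :* (𝟎 :- 𝟏) := 𝟏) refl)
                             (*-nonneg (x≤y⇒0≤y-x 1≤0) (x≤y⇒0≤y-x 1≤0))

  fromℕ-nonneg : ∀ n → 0# ≤ fromℕ R n
  fromℕ-nonneg zero    = ≤-refl
  fromℕ-nonneg (suc n) = +-nonneg 0≤1 (fromℕ-nonneg n)

  -- When b ≤ a, b - a = (1 + k)(b - a) + k(a - b) is a sum of nonnegative terms.
  fromℕ-suc-*-cancelˡ-≤ : ∀ k {a b} → fromℕ R (suc k) * a ≤ fromℕ R (suc k) * b → a ≤ b
  fromℕ-suc-*-cancelˡ-≤ k {a} {b} ka≤kb with total a b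
  ... | inj₁ a≤b = a≤b
  ... | inj₂ b≤a = ≤-by-diff
    (solve 3 (λ a b k → b :- a := ((𝟏 :+ k) :* b :- (𝟏 :+ k) :* a) :+ k :* (a :- b)) refl a b (fromℕ R k))
    (+-nonneg (x≤y⇒0≤y-x ka≤kb) (*-nonneg (fromℕ-nonneg k) (x≤y⇒0≤y-x b≤a)))

  ∑-cong : ∀ n {g h : Fin n → Carrier} → (∀ i → g i ≈ h i) → ∑ R n g ≈ ∑ R n h
  ∑-cong zero    g≈h = refl
  ∑-cong (suc n) g≈h = +-cong (g≈h zero) (∑-cong n (g≈h ∘ suc))

  ∏-cong : ∀ n {g h : Fin n → Carrier} → (∀ i → g i ≈ h i) → ∏ R n g ≈ ∏ R n h
  ∏-cong zero    g≈h = refl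
  ∏-cong (suc n) g≈h = *-cong (g≈h zero) (∏-cong n (g≈h ∘ suc))

  ∑-mono-≤ : ∀ n {g h : Fin n → Carrier} → (∀ i → g i ≤ h i) → ∑ R n g ≤ ∑ R n h
  ∑-mono-≤ zero    g≤h = ≤-refl
  ∑-mono-≤ (suc n) g≤h = +-mono-≤ (g≤h zero) (∑-mono-≤ n (g≤h ∘ suc))

  ∑-const : ∀ n x → ∑ R n (λ _ → x) ≈ fromℕ R n * x
  ∑-const zero    x = sym (zeroˡ x)
  ∑-const (suc n) x = trans (+-cong (sym (*-identityˡ x)) (∑-const n x)) (sym (distribʳ x 1# _))

  *-distribˡ-∑ : ∀ n a (g : Fin n → Carrier) → a * ∑ R n g ≈ ∑ R n (λ i → a * g i)
  *-distribˡ-∑ zero    a g = zeroʳ a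
  *-distribˡ-∑ (suc n) a g = trans (distribˡ a _ _) (+-cong refl (*-distribˡ-∑ n a (tail g)))

  ∑-removeAt : ∀ {n} (g : Fin (suc n) → Carrier) i → ∑ R (suc n) g ≈ g i + ∑ R n (removeAt g i)
  ∑-removeAt             g zero    = refl
  ∑-removeAt {n = suc n} g (suc i) = trans (+-cong refl (∑-removeAt (tail g) i))
    (solve 3 (λ a b c → a :+ (b :+ c) := b :+ (a :+ c)) refl _ _ _)

  ∏-removeAt : ∀ {n} (g : Fin (suc n) → Carrier) i → ∏ R (suc n) g ≈ g i * ∏ R n (removeAt g i)
  ∏-removeAt             g zero    = refl
  ∏-removeAt {n = suc n} g (suc i) = trans (*-cong refl (∏-removeAt (tail g) i))
    (solve 3 (λ a b c → a :* (b :* c) := b :* (a :* c)) refl _ _ _)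

  ∑-insertAt : ∀ {n} (g : Fin n → Carrier) i x → ∑ R (suc n) (insertAt g i x) ≈ x + ∑ R n g
  ∑-insertAt {n} g i x = trans (∑-removeAt (insertAt g i x) i)
    (+-cong (reflexive (insertAt-lookup g i x)) (∑-cong n (reflexive ∘ insertAt-punchIn g i x)))

  ∑-nonneg : ∀ n {g : Fin n → Carrier} → (∀ i → 0# ≤ g i) → 0# ≤ ∑ R n g
  ∑-nonneg n 0≤g = ≤-respˡ-≈ (trans (∑-const n 0#) (zeroʳ _)) (∑-mono-≤ n 0≤g)

  x≤∑ : ∀ {n} {g : Fin (suc n) → Carrier} → (∀ i → 0# ≤ g i) → ∀ i → g i ≤ ∑ R (suc n) g
  x≤∑ {n} {g} 0≤g i = ≤-respʳ-≈ (sym (∑-removeAt g i)) (x≤x+y (∑-nonneg n (0≤g ∘ punchIn i)))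

  min≤mean : ∀ {n} (y : Fin (suc n) → Carrier) {i μ} → (∀ l → y i ≤ y l) →
             ∑ R (suc n) y ≤ fromℕ R (suc n) * μ → y i ≤ μ
  min≤mean {n} y {i} min ∑y≤ = fromℕ-suc-*-cancelˡ-≤ n
    (≤-trans (≤-respˡ-≈ (∑-const (suc n) (y i)) (∑-mono-≤ (suc n) min)) ∑y≤)

  mean≤max : ∀ {n} (y : Fin (suc n) → Carrier) {j μ} → (∀ l → y l ≤ y j) →
             fromℕ R (suc n) * μ ≤ ∑ R (suc n) y → μ ≤ y j
  mean≤max {n} y {j} max ≤∑y = fromℕ-suc-*-cancelˡ-≤ n
    (≤-trans ≤∑y (≤-respʳ-≈ (∑-const (suc n) (y j)) (∑-mono-≤ (suc n) max)))

  argmin : ∀ n (y : Fin (suc n) → Carrier) → Σ (Fin (suc n)) λ i → ∀ l → y i ≤ y l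
  argmin zero    y = zero , λ { zero → ≤-refl }
  argmin (suc n) y with argmin n (tail y)
  ... | i , min with total (y zero) (y (suc i))
  ...   | inj₁ y₀≤ = zero  , λ { zero → ≤-refl ; (suc l) → ≤-trans y₀≤ (min l) }
  ...   | inj₂ ≤y₀ = suc i , λ { zero → ≤y₀   ; (suc l) → min l }

  argmax : ∀ n (y : Fin (suc n) → Carrier) → Σ (Fin (suc n)) λ i → ∀ l → y l ≤ y i
  argmax zero    y = zero , λ { zero → ≤-refl }
  argmax (suc n) y with argmax n (tail y)
  ... | i , max with total (y zero) (y (suc i))
  ...   | inj₁ y₀≤ = suc i , λ { zero → y₀≤   ; (suc l) → max l }
  ...   | inj₂ ≤y₀ = zero  , λ { zero → ≤-refl ; (suc l) → ≤-trans (max l) ≤y₀ }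

  insertAt-preserves : ∀ {p} (P : Carrier → Set p) {n} (g : Fin n → Carrier) i {x} →
                       P x → (∀ l → P (g l)) → ∀ l → P (insertAt g i x l)
  insertAt-preserves P g         zero    Px Pg zero    = Px
  insertAt-preserves P g         zero    Px Pg (suc l) = Pg l
  insertAt-preserves P {suc n} g (suc i) Px Pg zero    = Pg zero
  insertAt-preserves P {suc n} g (suc i) Px Pg (suc l) =
    insertAt-preserves P (tail g) i Px (Pg ∘ suc) l

  P₀ P₁ : ∀ n → (Fin n → Carrier) → Carrier
  P₀ n x = ∏ R n (λ j → 1# - x j)
  P₁ zero    x = 0#
  P₁ (suc n) x = x zero * P₀ n (tail x) + (1# - x zero) * P₁ n (tail x)

  P₀-cong : ∀ n {x y : Fin n → Carrier} → (∀ i → x i ≈ y i) → P₀ n x ≈ P₀ n y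
  P₀-cong n x≈y = ∏-cong n (λ i → +-cong refl (-‿cong (x≈y i)))

  P₁-cong : ∀ n {x y : Fin n → Carrier} → (∀ i → x i ≈ y i) → P₁ n x ≈ P₁ n y
  P₁-cong zero    x≈y = refl
  P₁-cong (suc n) x≈y = +-cong (*-cong (x≈y zero) (P₀-cong n (x≈y ∘ suc)))
    (*-cong (+-cong refl (-‿cong (x≈y zero))) (P₁-cong n (x≈y ∘ suc)))

  ∏-except-suc : ∀ {n} j (g : Fin (suc n) → Carrier) →
                 ∏-except R (suc n) (suc j) g ≈ g zero * ∏-except R n j (tail g)
  ∏-except-suc {n} j g = *-cong refl (∏-cong n except-suc)
    where
    except-suc : ∀ i → except R (suc j) g (suc i) ≈ except R j (tail g) i
    except-suc i with i ≟ j
    ... | yes _ = refl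
    ... | no  _ = refl

  ∑∏-except≈P₁ : ∀ n x → ∑ R n (λ j → x j * ∏-except R n j (λ k → 1# - x k)) ≈ P₁ n x
  ∑∏-except≈P₁ zero    x = refl
  ∑∏-except≈P₁ (suc n) x = +-cong (*-cong refl (*-identityˡ _)) (begin
    ∑ R n (λ j → x (suc j) * ∏-except R (suc n) (suc j) g)
      ≈⟨ ∑-cong n (λ j → *-cong refl (∏-except-suc j g)) ⟩
    ∑ R n (λ j → x (suc j) * (g zero * ∏-except R n j (tail g)))
      ≈⟨ ∑-cong n (λ j → solve 3 (λ a b c → a :* (b :* c) := b :* (a :* c)) refl _ _ _) ⟩
    ∑ R n (λ j → g zero * (x (suc j) * ∏-except R n j (tail g)))
      ≈⟨ sym (*-distribˡ-∑ n (g zero) _) ⟩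
    g zero * ∑ R n (λ j → x (suc j) * ∏-except R n j (tail g))
      ≈⟨ *-cong refl (∑∏-except≈P₁ n (tail x)) ⟩
    g zero * P₁ n (tail x) ∎)
    where
    open ≈-Reasoning
    g = λ k → 1# - x k

  f≈P₀+P₁ : ∀ n x → f R n x ≈ P₀ n x + P₁ n x
  f≈P₀+P₁ n x = +-cong refl (∑∏-except≈P₁ n x)

  P₀-removeAt : ∀ {n} (x : Fin (suc n) → Carrier) i →
                P₀ (suc n) x ≈ (1# - x i) * P₀ n (removeAt x i)
  P₀-removeAt x = ∏-removeAt (λ j → 1# - x j)

  P₁-removeAt : ∀ {n} (x : Fin (suc n) → Carrier) i →
                P₁ (suc n) x ≈ x i * P₀ n (removeAt x i) + (1# - x i) * P₁ n (removeAt x i)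
  P₁-removeAt             x zero    = refl
  P₁-removeAt {n = suc n} x (suc i) =
    trans (+-cong (*-cong refl (P₀-removeAt (tail x) i)) (*-cong refl (P₁-removeAt (tail x) i)))
      (solve 4 (λ x₀ t a b →
         x₀ :* ((𝟏 :- t) :* a) :+ (𝟏 :- x₀) :* (t :* a :+ (𝟏 :- t) :* b)
         := t :* ((𝟏 :- x₀) :* a) :+ (𝟏 :- t) :* (x₀ :* a :+ (𝟏 :- x₀) :* b)) refl _ _ _ _)

  P₀-nonneg : ∀ n {x : Fin n → Carrier} → (∀ i → x i ≤ 1#) → 0# ≤ P₀ n x
  P₀-nonneg zero    x≤1 = 0≤1
  P₀-nonneg (suc n) x≤1 = *-nonneg (x≤y⇒0≤y-x (x≤1 zero)) (P₀-nonneg n (x≤1 ∘ suc))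

  P₁-nonneg : ∀ n {x : Fin n → Carrier} → (∀ i → 0# ≤ x i) → (∀ i → x i ≤ 1#) → 0# ≤ P₁ n x
  P₁-nonneg zero    0≤x x≤1 = ≤-refl
  P₁-nonneg (suc n) 0≤x x≤1 = +-nonneg
    (*-nonneg (0≤x zero) (P₀-nonneg n (x≤1 ∘ suc)))
    (*-nonneg (x≤y⇒0≤y-x (x≤1 zero)) (P₁-nonneg n (0≤x ∘ suc) (x≤1 ∘ suc)))

  -- Removing r₀ = t replaces (c , d) by (c(1 - t) - dt , d(1 - t)), which again
  -- satisfies every hypothesis.
  P₁-bound : ∀ n (r : Fin n → Carrier) {M c d} →
             (∀ l → 0# ≤ r l) → (∀ l → r l ≤ M) → M ≤ 1# → 0# ≤ c → 0# ≤ d →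
             d * ∑ R n r ≤ c * (1# - M) → d * P₁ n r ≤ c * P₀ n r
  P₁-bound zero    r {c = c} {d} _ _ _ 0≤c _ _ =
    ≤-by-diff (solve 2 (λ c d → c :* 𝟏 :- d :* 𝟎 := c) refl c d) 0≤c
  P₁-bound (suc n) r {M} {c} {d} 0≤r r≤M M≤1 0≤c 0≤d d∑r≤ = ≤-by-diff
    (solve 5 (λ c d t a b →
       c :* ((𝟏 :- t) :* a) :- d :* (t :* a :+ (𝟏 :- t) :* b)
       := (c :* (𝟏 :- t) :- d :* t) :* a :- d :* (𝟏 :- t) :* b) refl c d t a b)
    (x≤y⇒0≤y-x (P₁-bound n (tail r) (0≤r ∘ suc) (r≤M ∘ suc) M≤1 0≤c′ (*-nonneg 0≤d 0≤1-t) d′∑≤))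
    where
    t = r zero
    S = ∑ R n (tail r)
    a = P₀ n (tail r)
    b = P₁ n (tail r)
    c′ = c * (1# - t) - d * t
    0≤1-t : 0# ≤ 1# - t
    0≤1-t = x≤y⇒0≤y-x (≤-trans (r≤M zero) M≤1)
    0≤budget : 0# ≤ c * (1# - M) - d * (t + S)
    0≤budget = x≤y⇒0≤y-x d∑r≤
    0≤c′ : 0# ≤ c′
    0≤c′ = ≤-respʳ-≈
      (solve 5 (λ c d M t S → ((c :* (𝟏 :- M) :- d :* (t :+ S)) :+ d :* S) :+ c :* (M :- t)
                              := c :* (𝟏 :- t) :- d :* t) refl c d M t S)
      (+-nonneg (+-nonneg 0≤budget (*-nonneg 0≤d (∑-nonneg n (0≤r ∘ suc))))
                (*-nonneg 0≤c (x≤y⇒0≤y-x (r≤M zero))))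
    d′∑≤ : d * (1# - t) * S ≤ c′ * (1# - M)
    d′∑≤ = ≤-by-diff
      (solve 5 (λ c d M t S →
         (c :* (𝟏 :- t) :- d :* t) :* (𝟏 :- M) :- d :* (𝟏 :- t) :* S
         := (𝟏 :- t) :* (c :* (𝟏 :- M) :- d :* (t :+ S)) :+ d :* (t :* (M :- t))) refl c d M t S)
      (+-nonneg (*-nonneg 0≤1-t 0≤budget) (*-nonneg 0≤d (*-nonneg (0≤r zero) (x≤y⇒0≤y-x (r≤M zero)))))

  record Weights : Set c where
    constructor ⟨_,_⟩
    field
      α β : Carrier

  open Weights

  Φ : Weights → ∀ n → (Fin n → Carrier) → Carrier
  Φ w n y = α w * P₀ n y + β w * P₁ n y

  slack : Weights → Carrier
  slack w = β w + β w - α w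

  peel : Carrier → Weights → Weights
  peel t w = ⟨ α w * (1# - t) + β w * t , β w * (1# - t) ⟩

  Φ-cong : ∀ w n {x y : Fin n → Carrier} → (∀ i → x i ≈ y i) → Φ w n x ≈ Φ w n y
  Φ-cong w n x≈y = +-cong (*-cong refl (P₀-cong n x≈y)) (*-cong refl (P₁-cong n x≈y))

  Φ-removeAt : ∀ w {n} (y : Fin (suc n) → Carrier) i →
               Φ w (suc n) y ≈ Φ (peel (y i) w) n (removeAt y i)
  Φ-removeAt w y i =
    trans (+-cong (*-cong refl (P₀-removeAt y i)) (*-cong refl (P₁-removeAt y i)))
      (solve 5 (λ α β t a b →
         α :* ((𝟏 :- t) :* a) :+ β :* (t :* a :+ (𝟏 :- t) :* b)
         := (α :* (𝟏 :- t) :+ β :* t) :* a :+ β :* (𝟏 :- t) :* b) refl (α w) (β w) (y i) _ _)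

  Φ-insertAt : ∀ w {n} (y : Fin n → Carrier) i t →
               Φ w (suc n) (insertAt y i t) ≈ Φ (peel t w) n y
  Φ-insertAt w {n} y i t = trans (Φ-removeAt w (insertAt y i t) i)
    (trans (reflexive (≡.cong (λ s → Φ (peel s w) n (removeAt (insertAt y i t) i)) (insertAt-lookup y i t)))
           (Φ-cong (peel t w) n (reflexive ∘ insertAt-punchIn y i t)))

  -- With s = u + v and p = uv, peeling u and then v leaves weights affine in s and p;
  -- replacing (u , v) by (m , u + v - m) keeps s and raises p by (m - u)(v - m).
  Φ-smooth : ∀ w {n} (r : Fin n → Carrier) {m u v} →
             β w * P₁ n r ≤ slack w * P₀ n r → 0# ≤ (m - u) * (v - m) →
             Φ (peel (u + v - m) (peel m w)) n r ≤ Φ (peel v (peel u w)) n r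
  Φ-smooth w {n} r {m} {u} {v} βb≤slack·a 0≤gain = ≤-by-diff
    (solve 7 (λ α β m u v a b →
       ((α :* (𝟏 :- u) :+ β :* u) :* (𝟏 :- v) :+ β :* (𝟏 :- u) :* v) :* a
         :+ β :* (𝟏 :- u) :* (𝟏 :- v) :* b
       :- (((α :* (𝟏 :- m) :+ β :* m) :* (𝟏 :- (u :+ v :- m)) :+ β :* (𝟏 :- m) :* (u :+ v :- m)) :* a
         :+ β :* (𝟏 :- m) :* (𝟏 :- (u :+ v :- m)) :* b)
       := ((m :- u) :* (v :- m)) :* ((β :+ β :- α) :* a :- β :* b))
       refl (α w) (β w) m u v (P₀ n r) (P₁ n r))
    (*-nonneg 0≤gain (x≤y⇒0≤y-x βb≤slack·a))

  module Smoothing (μ : Carrier) (0≤μ : 0# ≤ μ) where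

    -- Invariant of the induction on the dimension suc k: it survives peeling off a
    -- coordinate equal to μ and supplies the budget hypothesis of P₁-bound.
    record Admissible (w : Weights) (k : ℕ) : Set ℓ where
      field
        0≤β         : 0# ≤ β w
        β≤α         : β w ≤ α w
        0≤slack     : 0# ≤ slack w
        slack-bound : β w * (fromℕ R k * μ) ≤ slack w * (1# - μ)
        mass≤1      : fromℕ R (suc k) * μ ≤ 1#

    Admissible-peel : ∀ {w k} → Admissible w (suc k) → Admissible (peel μ w) k
    Admissible-peel {w} {k} adm = record
      { 0≤β         = *-nonneg 0≤β 0≤1-μ
      ; β≤α         = ≤-by-diff
          (solve 3 (λ α β μ → (α :* (𝟏 :- μ) :+ β :* μ) :- β :* (𝟏 :- μ)
                              := (α :- β) :* (𝟏 :- μ) :+ β :* μ) refl (α w) (β w) μ)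
          (+-nonneg (*-nonneg (x≤y⇒0≤y-x β≤α) 0≤1-μ) (*-nonneg 0≤β 0≤μ))
      ; 0≤slack     = ≤-respʳ-≈
          (solve 4 (λ α β μ K → ((β :+ β :- α) :* (𝟏 :- μ) :- β :* ((𝟏 :+ K) :* μ)) :+ β :* (K :* μ)
                                := β :* (𝟏 :- μ) :+ β :* (𝟏 :- μ) :- (α :* (𝟏 :- μ) :+ β :* μ))
                   refl (α w) (β w) μ (fromℕ R k))
          (+-nonneg 0≤slack-gap (*-nonneg 0≤β (*-nonneg (fromℕ-nonneg k) 0≤μ)))
      ; slack-bound = ≤-by-diff
          (solve 4 (λ α β μ K →
             (β :* (𝟏 :- μ) :+ β :* (𝟏 :- μ) :- (α :* (𝟏 :- μ) :+ β :* μ)) :* (𝟏 :- μ)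
               :- β :* (𝟏 :- μ) :* (K :* μ)
             := (𝟏 :- μ) :* ((β :+ β :- α) :* (𝟏 :- μ) :- β :* ((𝟏 :+ K) :* μ)))
             refl (α w) (β w) μ (fromℕ R k))
          (*-nonneg 0≤1-μ 0≤slack-gap)
      ; mass≤1      = ≤-by-diff
          (solve 2 (λ μ K → 𝟏 :- K :* μ := (𝟏 :- (𝟏 :+ K) :* μ) :+ μ) refl μ (fromℕ R (suc k)))
          (+-nonneg (x≤y⇒0≤y-x mass≤1) 0≤μ)
      }
      where
      open Admissible adm
      0≤1-μ : 0# ≤ 1# - μ
      0≤1-μ = ≤-respʳ-≈
        (solve 2 (λ μ K → (𝟏 :- (𝟏 :+ K) :* μ) :+ K :* μ := 𝟏 :- μ) refl μ (fromℕ R (suc k)))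
        (+-nonneg (x≤y⇒0≤y-x mass≤1) (*-nonneg (fromℕ-nonneg (suc k)) 0≤μ))
      0≤slack-gap : 0# ≤ slack w * (1# - μ) - β w * (fromℕ R (suc k) * μ)
      0≤slack-gap = x≤y⇒0≤y-x slack-bound

    module SmoothingStep {k} {w} (adm : Admissible w (suc k))
      (y : Fin (suc (suc k)) → Carrier) (0≤y : ∀ l → 0# ≤ y l)
      (∑y : ∑ R (suc (suc k)) y ≈ fromℕ R (suc (suc k)) * μ) where

      open Admissible adm

      i = proj₁ (argmin (suc k) y)
      u = y i
      z₀ = removeAt y i
      j = proj₁ (argmax k z₀)
      v = z₀ j
      r = removeAt z₀ j
      z = insertAt r j (u + v - μ)

      ∑y-split : u + ∑ R (suc k) z₀ ≈ fromℕ R (suc (suc k)) * μ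
      ∑y-split = trans (sym (∑-removeAt y i)) ∑y

      mass-split : fromℕ R (suc k) * μ ≈ (u + (v + ∑ R k r)) - μ
      mass-split = begin
        fromℕ R (suc k) * μ               ≈⟨ solve 2 (λ K μ → K :* μ := (𝟏 :+ K) :* μ :- μ) refl _ μ ⟩
        fromℕ R (suc (suc k)) * μ - μ     ≈⟨ +-cong (sym ∑y-split) refl ⟩
        (u + ∑ R (suc k) z₀) - μ          ≈⟨ +-cong (+-cong refl (∑-removeAt z₀ j)) refl ⟩
        (u + (v + ∑ R k r)) - μ           ∎
        where open ≈-Reasoning

      u≤μ : u ≤ μ
      u≤μ = min≤mean y (proj₂ (argmin (suc k) y)) (≤-reflexive ∑y)

      μ≤v : μ ≤ v
      μ≤v = mean≤max z₀ (proj₂ (argmax k z₀))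
        (+-cancel-≤ (trans ∑y-split (solve 2 (λ μ K → (𝟏 :+ K) :* μ := μ :+ K :* μ) refl μ _)) u≤μ)

      v≤1 : v ≤ 1#
      v≤1 = begin
        v                          ≤⟨ x≤∑ (0≤y ∘ punchIn i) j ⟩
        ∑ R (suc k) z₀             ≤⟨ ≤-respʳ-≈ (+-comm _ u) (x≤x+y (0≤y i)) ⟩
        u + ∑ R (suc k) z₀         ≈⟨ ∑y-split ⟩
        fromℕ R (suc (suc k)) * μ  ≤⟨ mass≤1 ⟩
        1#                         ∎
        where open ≤-Reasoning

      0≤z : ∀ l → 0# ≤ z l
      0≤z = insertAt-preserves (0# ≤_) r j
        (≤-respʳ-≈ (sym (+-assoc u v (- μ))) (+-nonneg (0≤y i) (x≤y⇒0≤y-x μ≤v)))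
        (0≤y ∘ punchIn i ∘ punchIn j)

      ∑z : ∑ R (suc k) z ≈ fromℕ R (suc k) * μ
      ∑z = begin
        ∑ R (suc k) z             ≈⟨ ∑-insertAt r j (u + v - μ) ⟩
        (u + v - μ) + ∑ R k r     ≈⟨ solve 4 (λ u v μ S → (u :+ v :- μ) :+ S := (u :+ (v :+ S)) :- μ)
                                            refl u v μ _ ⟩
        (u + (v + ∑ R k r)) - μ   ≈⟨ sym mass-split ⟩
        fromℕ R (suc k) * μ       ∎
        where open ≈-Reasoning

      β∑r≤slack : β w * ∑ R k r ≤ slack w * (1# - v)
      β∑r≤slack = ≤-by-diff
        (solve 6 (λ α β u v μ S →
           (β :+ β :- α) :* (𝟏 :- v) :- β :* S
           := (((β :+ β :- α) :* (𝟏 :- μ) :- β :* ((u :+ (v :+ S)) :- μ)) :+ (α :- β) :* (v :- μ))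
              :+ β :* u) refl (α w) (β w) u v μ _)
        (+-nonneg (+-nonneg (x≤y⇒0≤y-x (≤-respˡ-≈ (*-cong refl mass-split) slack-bound))
                            (*-nonneg (x≤y⇒0≤y-x β≤α) (x≤y⇒0≤y-x μ≤v)))
                  (*-nonneg 0≤β (0≤y i)))

      Φz≤Φy : Φ (peel μ w) (suc k) z ≤ Φ w (suc (suc k)) y
      Φz≤Φy = begin
        Φ (peel μ w) (suc k) z                ≈⟨ Φ-insertAt (peel μ w) r j (u + v - μ) ⟩
        Φ (peel (u + v - μ) (peel μ w)) k r   ≤⟨ Φ-smooth w r βP₁≤slack·P₀ 0≤gain ⟩
        Φ (peel v (peel u w)) k r             ≈⟨ sym (Φ-removeAt (peel u w) z₀ j) ⟩
        Φ (peel u w) (suc k) z₀               ≈⟨ sym (Φ-removeAt w y i) ⟩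
        Φ w (suc (suc k)) y                   ∎
        where
        open ≤-Reasoning
        βP₁≤slack·P₀ = P₁-bound k r (0≤y ∘ punchIn i ∘ punchIn j)
          (proj₂ (argmax k z₀) ∘ punchIn j) v≤1 0≤slack 0≤β β∑r≤slack
        0≤gain = *-nonneg (x≤y⇒0≤y-x u≤μ) (x≤y⇒0≤y-x μ≤v)

    Φ-const-≤ : ∀ k w → Admissible w k → (y : Fin (suc k) → Carrier) → (∀ l → 0# ≤ y l) →
                ∑ R (suc k) y ≈ fromℕ R (suc k) * μ → Φ w (suc k) (λ _ → μ) ≤ Φ w (suc k) y
    Φ-const-≤ zero    w _   y _   ∑y = ≤-reflexive (Φ-cong w 1 {λ _ → μ} {y} λ { zero → μ≈y₀ })
      where
      μ≈y₀ : μ ≈ y zero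
      μ≈y₀ = sym (trans (sym (+-identityʳ _))
                        (trans ∑y (solve 1 (λ μ → (𝟏 :+ 𝟎) :* μ := μ) refl μ)))
    Φ-const-≤ (suc k) w adm y 0≤y ∑y = begin
      Φ w (suc (suc k)) (λ _ → μ)   ≈⟨ Φ-removeAt w {suc k} (λ _ → μ) zero ⟩
      Φ (peel μ w) (suc k) (λ _ → μ) ≤⟨ Φ-const-≤ k (peel μ w) (Admissible-peel adm) z 0≤z ∑z ⟩
      Φ (peel μ w) (suc k) z        ≤⟨ Φz≤Φy ⟩
      Φ w (suc (suc k)) y           ∎
      where
      open SmoothingStep adm y 0≤y ∑y
      open ≤-Reasoning

    Admissible-unit : ∀ m → fromℕ R (suc m) * μ ≈ 1# → Admissible ⟨ 1# , 1# ⟩ m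
    Admissible-unit m mμ≈1 = record
      { 0≤β         = 0≤1
      ; β≤α         = ≤-refl
      ; 0≤slack     = ≤-respʳ-≈ (solve 0 (𝟏 := 𝟏 :+ 𝟏 :- 𝟏) refl) 0≤1
      ; slack-bound = ≤-by-diff
          (solve 2 (λ K μ → (𝟏 :+ 𝟏 :- 𝟏) :* (𝟏 :- μ) :- 𝟏 :* (K :* μ) := 𝟏 :- (𝟏 :+ K) :* μ)
                 refl (fromℕ R m) μ)
          (x≤y⇒0≤y-x (≤-reflexive mμ≈1))
      ; mass≤1      = ≤-reflexive mμ≈1
      }

  fromℕ-*≈1⇒0≤ : ∀ n {q} → fromℕ R n * q ≈ 1# → 0# ≤ q
  fromℕ-*≈1⇒0≤ n {q} nq≈1 with total 0# q
  ... | inj₁ 0≤q = 0≤q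
  ... | inj₂ q≤0 = ⊥-elim (0≉1 (antisym 0≤1 1≤0))
    where
    1≤0 : 1# ≤ 0#
    1≤0 = ≤-respˡ-≈ nq≈1 (≤-by-diff (solve 2 (λ n q → 𝟎 :- n :* q := n :* (𝟎 :- q)) refl _ q)
                                     (*-nonneg (fromℕ-nonneg n) (x≤y⇒0≤y-x q≤0)))

  P₀-const : ∀ n q → P₀ n (λ _ → q) ≈ pow R (1# - q) n
  P₀-const zero    q = refl
  P₀-const (suc n) q = *-cong refl (P₀-const n q)

  P₁-const : ∀ n q → P₁ (suc n) (λ _ → q) ≈ fromℕ R (suc n) * q * pow R (1# - q) n
  P₁-const zero    q = solve 1 (λ q → q :* 𝟏 :+ (𝟏 :- q) :* 𝟎 := (𝟏 :+ 𝟎) :* q :* 𝟏) refl q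
  P₁-const (suc n) q =
    trans (+-cong (*-cong refl (P₀-const (suc n) q)) (*-cong refl (P₁-const n q)))
      (solve 3 (λ q K p → q :* ((𝟏 :- q) :* p) :+ (𝟏 :- q) :* (K :* q :* p)
                          := (𝟏 :+ K) :* q :* ((𝟏 :- q) :* p)) refl q (fromℕ R (suc n)) _)

  Φ-unit : ∀ n x → Φ ⟨ 1# , 1# ⟩ n x ≈ P₀ n x + P₁ n x
  Φ-unit n x = +-cong (*-identityˡ _) (*-identityˡ _)

  P₀+P₁-raise-head : ∀ {n} x₀ (t : Fin n → Carrier) {s} → 0# ≤ s → 0# ≤ P₁ n t →
    P₀ (suc n) ((x₀ + s) ∷ t) + P₁ (suc n) ((x₀ + s) ∷ t) ≤ P₀ (suc n) (x₀ ∷ t) + P₁ (suc n) (x₀ ∷ t)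
  P₀+P₁-raise-head {n} x₀ t {s} 0≤s 0≤P₁t = ≤-by-diff
    (solve 4 (λ x₀ s a b →
       ((𝟏 :- x₀) :* a :+ (x₀ :* a :+ (𝟏 :- x₀) :* b))
       :- ((𝟏 :- (x₀ :+ s)) :* a :+ ((x₀ :+ s) :* a :+ (𝟏 :- (x₀ :+ s)) :* b))
       := s :* b) refl x₀ s (P₀ n t) (P₁ n t))
    (*-nonneg 0≤s 0≤P₁t)

  f-const : ∀ m q → fromℕ R (suc m) * q ≈ 1# →
            f R (suc m) (λ _ → q) ≈ pow R (1# - q) (suc m) + pow R (1# - q) m
  f-const m q mq≈1 = begin
    f R (suc m) (λ _ → q)                                  ≈⟨ f≈P₀+P₁ (suc m) (λ _ → q) ⟩
    P₀ (suc m) (λ _ → q) + P₁ (suc m) (λ _ → q)            ≈⟨ +-cong (P₀-const (suc m) q) (P₁-const m q) ⟩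
    pow R (1# - q) (suc m) + fromℕ R (suc m) * q * pow R (1# - q) m
      ≈⟨ +-cong refl (trans (*-cong mq≈1 refl) (*-identityˡ _)) ⟩
    pow R (1# - q) (suc m) + pow R (1# - q) m              ∎
    where open ≈-Reasoning

  f-lower-bound : ∀ m q → fromℕ R (suc m) * q ≈ 1# →
    (x : Fin (suc m) → Carrier) → (∀ i → 0# ≤ x i) → ∑ R (suc m) x ≤ 1# →
    (pow R (1# - q) (suc m) + pow R (1# - q) m) ≤ f R (suc m) x
  f-lower-bound m q mq≈1 x 0≤x ∑x≤1 = begin
    pow R (1# - q) (suc m) + pow R (1# - q) m  ≈⟨ sym (f-const m q mq≈1) ⟩
    f R (suc m) (λ _ → q)                      ≈⟨ trans (f≈P₀+P₁ (suc m) (λ _ → q)) (sym (Φ-unit (suc m) (λ _ → q))) ⟩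
    Φ ⟨ 1# , 1# ⟩ (suc m) (λ _ → q)            ≤⟨ Φ-const-≤ m ⟨ 1# , 1# ⟩ (Admissible-unit m mq≈1) x′ 0≤x′ ∑x′ ⟩
    Φ ⟨ 1# , 1# ⟩ (suc m) x′                   ≈⟨ Φ-unit (suc m) x′ ⟩
    P₀ (suc m) x′ + P₁ (suc m) x′              ≤⟨ P₀+P₁-raise-head (x zero) (tail x) (x≤y⇒0≤y-x ∑x≤1) 0≤P₁ ⟩
    P₀ (suc m) x + P₁ (suc m) x                ≈⟨ sym (f≈P₀+P₁ (suc m) x) ⟩
    f R (suc m) x                              ∎
    where
    open ≤-Reasoning
    open Smoothing q (fromℕ-*≈1⇒0≤ (suc m) mq≈1)
    x′ = (x zero + (1# - ∑ R (suc m) x)) ∷ tail x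
    0≤x′ : ∀ i → 0# ≤ x′ i
    0≤x′ zero    = +-nonneg (0≤x zero) (x≤y⇒0≤y-x ∑x≤1)
    0≤x′ (suc i) = 0≤x (suc i)
    ∑x′ : ∑ R (suc m) x′ ≈ fromℕ R (suc m) * q
    ∑x′ = trans (solve 2 (λ x₀ S → (x₀ :+ (𝟏 :- (x₀ :+ S))) :+ S := 𝟏) refl (x zero) _) (sym mq≈1)
    0≤P₁ : 0# ≤ P₁ m (tail x)
    0≤P₁ = P₁-nonneg m (0≤x ∘ suc) (λ i → ≤-trans (x≤∑ 0≤x (suc i)) ∑x≤1)

mainTheorem4 : ∀ {c ℓ} (R : RealField c ℓ) → let open RealField R in
    (n : ℕ) → 1 ≤ℕ n →
    (q : Carrier) → fromℕ R n * q ≈ 1# →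
    ((x : Fin n → Carrier) → (∀ i → 0# ≤ x i) → ∑ R n x ≤ 1# →
       (pow R (1# - q) n + pow R (1# - q) (n ∸ 1)) ≤ f R n x)
    × (f R n (λ _ → q) ≈ pow R (1# - q) n + pow R (1# - q) (n ∸ 1))
mainTheorem4 R (suc m) _ q mq≈1 = f-lower-bound m q mq≈1 , f-const m q mq≈1
  where open Proof R
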